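{- Let $L=(V,E)$ be a connected $\bar d$-regular finite simple graph on $\bar n$ vertices and $k\in\{1,\dots,\bar n-1\}$. Let $D_k=\{\mathrm{deg}_k(\mathfrak{v})\mid \mathfrak{v}\in\mathfrak{V}_k\}$, let $l\in D_k$, let $\mathfrak{V}_{D_k;l}:=\{\mathfrak{v}\in \mathfrak{V}_k\mid\mathrm{deg}_k(\mathfrak{v})=l\}$, and for $j\in\mathbb{N}$ let $\mathfrak{L}_{k;j}$ be the set of vertex induced subgraphs of $L$ on $k$ vertices containing exactly $j$ edges. Then \[ \left|\mathfrak{V}_{D_k;l}\right|=\left|\mathfrak{L}_{k;\frac{k\bar{d}-l}{2}}\right| \quad\text{and}\quad \left|\mathfrak{L}_{k;\frac{k\bar{d}-l}{2}}\right| = \left|\mathfrak{L}_{\bar{n}-k;\frac{(\bar{n}-k)\bar{d}-l}{2}}\right|. \]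
   Context: For a finite simple graph $L=(V,E)$ and $k\in\{1,\dots,|V|-1\}$, the $k$-particle graph $\mathfrak{L}_k=(\mathfrak{V}_k,\mathfrak{E}_k)$ of $L$ has vertex set $\mathfrak{V}_k$ the $k$-element subsets of $V$, two vertices $\mathfrak{v},\mathfrak{w}$ being adjacent iff $\mathfrak{v}\triangle\mathfrak{w}=\{v,w\}$ for some edge $\langle v,w\rangle\in E$; $\mathrm{deg}_k(\mathfrak{v})$ is the degree of $\mathfrak{v}$ in $\mathfrak{L}_k$. Vertex induced subgraphs on $k$ vertices are identified with the $k$-subsets of $V$ inducing them. -}

module Defs where

open import Data.Nat using (ℕ; zero; suc; _+_; _*_; _∸_; _≤_; _<_)
open import Data.Bool using (Bool; true; false; _xor_)
open import Data.Bool.Properties using () renaming (_≟_ to _≟ᵇ_)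
open import Data.Fin using (Fin)
open import Data.Fin.Subset using (Subset; ⁅_⁆; _∪_; _⊆_; ∣_∣)
open import Data.Fin.Properties using (any?)
import Data.Fin.Subset.Properties
import Data.Nat
import Data.List
open import Data.Vec using (Vec; []; _∷_; zipWith)
open import Data.Vec.Properties using (≡-dec)
open import Data.List using (List; []; _∷_; _++_; map; filter; length)
open import Data.Product using (Σ; _×_; _,_; ∃)
open import Relation.Nullary using (Dec; yes; no)
open import Relation.Nullary.Decidable using (_×-dec_)
open import Relation.Binary.PropositionalEquality using (_≡_)

record SimpleGraph (n : ℕ) : Set where
  field
    Adj    : Fin n → Fin n → Bool
    sym    : ∀ v w → Adj v w ≡ Adj w v
    irrefl : ∀ v → Adj v v ≡ false
open SimpleGraph public

allSubsets : (n : ℕ) → List (Subset n)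
allSubsets zero    = [] ∷ []
allSubsets (suc n) = map (true ∷_) (allSubsets n) ++ map (false ∷_) (allSubsets n)

allFin : (n : ℕ) → List (Fin n)
allFin n = Data.List.allFin n

count : {A : Set} {P : A → Set} → (∀ x → Dec (P x)) → List A → ℕ
count P? xs = length (filter P? xs)

_△_ : {n : ℕ} → Subset n → Subset n → Subset n
_△_ = zipWith _xor_

_≟ˢ_ : {n : ℕ} (p q : Subset n) → Dec (p ≡ q)
_≟ˢ_ = ≡-dec _≟ᵇ_

degree : {n : ℕ} → SimpleGraph n → Fin n → ℕ
degree {n} L v = count (λ w → Adj L v w ≟ᵇ true) (allFin n)

Regular : {n : ℕ} → SimpleGraph n → ℕ → Set
Regular L d = ∀ v → degree L v ≡ d

data Walk {n : ℕ} (L : SimpleGraph n) : Fin n → Fin n → Set where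
  nil  : ∀ {v} → Walk L v v
  cons : ∀ {u v w} → Adj L u v ≡ true → Walk L v w → Walk L u w

Connected : {n : ℕ} → SimpleGraph n → Set
Connected L = ∀ v w → Walk L v w

IsEdge : {n : ℕ} → SimpleGraph n → Subset n → Set
IsEdge {n} L e = ∃ λ (v : Fin n) → ∃ λ (w : Fin n) → (Adj L v w ≡ true) × (e ≡ ⁅ v ⁆ ∪ ⁅ w ⁆)

isEdge? : {n : ℕ} (L : SimpleGraph n) (e : Subset n) → Dec (IsEdge L e)
isEdge? L e = any? (λ v → any? (λ w → (Adj L v w ≟ᵇ true) ×-dec (e ≟ˢ (⁅ v ⁆ ∪ ⁅ w ⁆))))

-- adjacency in the k-particle graph: 𝔳 △ 𝔴 = {v,w} for an edge ⟨v,w⟩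
-- (both 𝔳 and 𝔴 are required to be k-subsets by the degree below)
ParticleAdj : {n : ℕ} → SimpleGraph n → Subset n → Subset n → Set
ParticleAdj L 𝔳 𝔴 = IsEdge L (𝔳 △ 𝔴)

degₖ : {n : ℕ} → SimpleGraph n → (k : ℕ) → Subset n → ℕ
degₖ {n} L k 𝔳 =
  count (λ 𝔴 → (∣ 𝔴 ∣ Data.Nat.≟ k) ×-dec isEdge? L (𝔳 △ 𝔴)) (allSubsets n)

VDk : {n : ℕ} → SimpleGraph n → (k l : ℕ) → Subset n → Set
VDk L k l 𝔳 = (∣ 𝔳 ∣ ≡ k) × (degₖ L k 𝔳 ≡ l)

cardVDk : {n : ℕ} → SimpleGraph n → (k l : ℕ) → ℕ
cardVDk {n} L k l =
  count (λ 𝔳 → (∣ 𝔳 ∣ Data.Nat.≟ k) ×-dec (degₖ L k 𝔳 Data.Nat.≟ l)) (allSubsets n)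

inducedEdges : {n : ℕ} → SimpleGraph n → Subset n → ℕ
inducedEdges {n} L S =
  count (λ e → (∣ e ∣ Data.Nat.≟ 2) ×-dec ((Data.Fin.Subset.Properties._⊆?_ e S) ×-dec isEdge? L e))
        (allSubsets n)

cardLkj : {n : ℕ} → SimpleGraph n → (k j : ℕ) → ℕ
cardLkj {n} L k j =
  count (λ S → (∣ S ∣ Data.Nat.≟ k) ×-dec (inducedEdges L S Data.Nat.≟ j)) (allSubsets n)

InDk : {n : ℕ} → SimpleGraph n → (k l : ℕ) → Set
InDk {n} L k l = ∃ λ (𝔳 : Subset n) → VDk L k l 𝔳

-- For a k-set S of vertices of a d-regular graph, the neighbours of S in the
-- k-particle graph are the sets S △ {v,w} with {v,w} an edge having exactly one
-- end in S, so deg_k(S) is the number of edges leaving S.  Counting the k·d edge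
-- ends at vertices of S gives k·d = deg_k(S) + 2·e(S); the edges leaving S are the
-- edges leaving V∖S, so also (n−k)·d = deg_k(S) + 2·e(V∖S).  Hence among k-sets the
-- conditions deg_k(S) = l, e(S) = (k·d − l)/2 and e(V∖S) = ((n−k)·d − l)/2 are
-- equivalent, and complementation is a bijection between k-sets and (n−k)-sets.

module Submission where

open import Defs
open import Data.Nat using (ℕ; _*_; _∸_; _/_; _≤_; _<_)
open import Relation.Binary.PropositionalEquality using (_≡_)
open import Data.Product using (_×_)

open import Data.Nat.Properties hiding (_≟_)
open import Algebra.Properties.CommutativeSemigroup +-commutativeSemigroup using (interchange)
open import Algebra.Properties.CommutativeMonoid.Sum +-0-commutativeMonoid
  using (sum-syntax; sum-cong-≗; ∑-distrib-+; ∑-comm; sum-replicate-zero)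
open import Algebra.Properties.Semiring.Sum +-*-semiring using (*-distribˡ-sum; *-distribʳ-sum)
open import Data.Bool using (Bool; true; false; _∧_; _∨_; _xor_; not)
open import Data.Bool.Properties using (not-involutive; ∧-assoc) renaming (_≟_ to _≟ᵇ_)
open import Data.Fin using (Fin; _≟_) renaming (zero to fzero; suc to fsuc)
open import Data.Fin.Subset using (Subset; ⁅_⁆; _∪_; _∩_; ∁; ⊤; ∣_∣; _∈_)
open import Data.Fin.Subset.Properties
  using (_⊆?_; ∣p∣≤n; ∣∁p∣≡n∸∣p∣; ∪-comm; ∩-identityˡ; x∈⁅x⁆; x∈⁅y⁆⇒x≡y; p⊆p∪q; q⊆p∪q;
         x∈p∪q⁻)
open import Data.List using ([]; _∷_; _++_; map; tabulate; filter; length)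
import Data.List.Properties as List
open import Data.Nat using (zero; suc; _+_) renaming (_≟_ to _≟ℕ_)
open import Data.Nat.DivMod using (m*n/n≡m)
open import Data.Product using (_,_)
open import Data.Sum as Sum using (_⊎_; inj₁; inj₂)
open import Data.Vec using ([]; _∷_; lookup)
import Data.Vec.Properties as Vec
open import Function using (_∘_)
open import Function.Bundles using (_⇔_; Equivalence; mk⇔)
import Function.Properties.Equivalence as ⇔
open import Relation.Binary.PropositionalEquality as ≡ using (refl; cong; cong₂; _≢_)
open import Relation.Nullary using (Dec; yes; no; does; ¬_; contradiction)
open import Relation.Nullary.Decidable using (dec-true; dec-false; _×-dec_)

open ≡.≡-Reasoning

⟦_⟧ : Bool → ℕ
⟦ true  ⟧ = 1
⟦ false ⟧ = 0

⟦∧⟧ : ∀ a b → ⟦ a ∧ b ⟧ ≡ ⟦ a ⟧ * ⟦ b ⟧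
⟦∧⟧ true  b = ≡.sym (+-identityʳ ⟦ b ⟧)
⟦∧⟧ false b = refl

⟦⟧*⟦⟧≡0 : ∀ {P Q : Set} (P? : Dec P) (Q? : Dec Q) → ¬ (P × Q) →
          ⟦ does P? ⟧ * ⟦ does Q? ⟧ ≡ 0
⟦⟧*⟦⟧≡0 P? Q? ¬P×Q =
  ≡.trans (≡.sym (⟦∧⟧ (does P?) (does Q?))) (cong ⟦_⟧ (dec-false (P? ×-dec Q?) ¬P×Q))

a+2b≡c+2d⇒a≡c⇔b≡d : ∀ {a b c d} → a + 2 * b ≡ c + 2 * d → (a ≡ c) ⇔ (b ≡ d)
a+2b≡c+2d⇒a≡c⇔b≡d {a} {b} {c} {d} eq = mk⇔
  (λ { refl → *-cancelˡ-≡ b d 2 (+-cancelˡ-≡ a _ _ eq) })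
  (λ { refl → +-cancelʳ-≡ (2 * b) a c eq })

[m∸l]/2≡e : ∀ {l e m} → l + 2 * e ≡ m → (m ∸ l) / 2 ≡ e
[m∸l]/2≡e {l} {e} refl = begin
  (l + 2 * e ∸ l) / 2 ≡⟨ cong (_/ 2) (m+n∸m≡n l (2 * e)) ⟩
  2 * e / 2           ≡⟨ cong (_/ 2) (*-comm 2 e) ⟩
  e * 2 / 2           ≡⟨ m*n/n≡m e 2 ⟩
  e                   ∎

×-⇔ : ∀ {A A′ B B′ : Set} → A ⇔ A′ → (A → B ⇔ B′) → (A × B) ⇔ (A′ × B′)
×-⇔ A⇔A′ B⇔B′ = mk⇔ (λ (a , b) → Equivalence.to A⇔A′ a , Equivalence.to (B⇔B′ a) b)
                    (λ (a′ , b′) → let a = Equivalence.from A⇔A′ a′ in a , Equivalence.from (B⇔B′ a) b′)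

-- Sums over vertices and over subsets

∑-δ : ∀ {n} (a : Fin n) (f : Fin n → ℕ) → ∑[ i < n ] (⟦ does (i ≟ a) ⟧ * f i) ≡ f a
∑-δ {suc n} fzero    f = ≡.trans (cong₂ _+_ (+-identityʳ (f fzero)) (sum-replicate-zero n)) (+-identityʳ _)
∑-δ {suc n} (fsuc a) f = ∑-δ a (λ i → f (fsuc i))

∑² : ∀ {n} → (Fin n → Fin n → ℕ) → ℕ
∑² {n} f = ∑[ v < n ] ∑[ w < n ] f v w

∑²-cong : ∀ {n} {f g : Fin n → Fin n → ℕ} → (∀ v w → f v w ≡ g v w) → ∑² f ≡ ∑² g
∑²-cong f≗g = sum-cong-≗ (λ v → sum-cong-≗ (f≗g v))

∑²-zero : ∀ {n} → ∑² {n} (λ _ _ → 0) ≡ 0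
∑²-zero {n} = begin
  ∑² {n} (λ _ _ → 0) ≡⟨ sum-cong-≗ {n} (λ _ → sum-replicate-zero n) ⟩
  ∑[ v < n ] 0       ≡⟨ sum-replicate-zero n ⟩
  0                  ∎

∑²-distrib-+ : ∀ {n} (f g : Fin n → Fin n → ℕ) → ∑² (λ v w → f v w + g v w) ≡ ∑² f + ∑² g
∑²-distrib-+ f g = ≡.trans (sum-cong-≗ (λ v → ∑-distrib-+ (f v) (g v)))
                           (∑-distrib-+ (λ v → ∑[ w < _ ] f v w) (λ v → ∑[ w < _ ] g v w))

*-distribˡ-∑² : ∀ {n} c (f : Fin n → Fin n → ℕ) → c * ∑² f ≡ ∑² (λ v w → c * f v w)
*-distribˡ-∑² c f = ≡.trans (*-distribˡ-sum c (λ v → ∑[ w < _ ] f v w))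
                            (sum-cong-≗ (λ v → *-distribˡ-sum c (f v)))

∑²-δ : ∀ {n} (a b : Fin n) → ∑² (λ v w → ⟦ does (v ≟ a) ⟧ * ⟦ does (w ≟ b) ⟧) ≡ 1
∑²-δ {n} a b = begin
  ∑² (λ v w → ⟦ does (v ≟ a) ⟧ * ⟦ does (w ≟ b) ⟧)
    ≡⟨ sum-cong-≗ (λ v → *-distribˡ-sum ⟦ does (v ≟ a) ⟧ (λ w → ⟦ does (w ≟ b) ⟧)) ⟨
  ∑[ v < n ] (⟦ does (v ≟ a) ⟧ * ∑[ w < n ] ⟦ does (w ≟ b) ⟧)
    ≡⟨ ∑-δ a _ ⟩
  ∑[ w < n ] ⟦ does (w ≟ b) ⟧
    ≡⟨ sum-cong-≗ (λ w → *-identityʳ ⟦ does (w ≟ b) ⟧) ⟨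
  ∑[ w < n ] (⟦ does (w ≟ b) ⟧ * 1)
    ≡⟨ ∑-δ b _ ⟩
  1 ∎

∑ˢ : (n : ℕ) → (Subset n → ℕ) → ℕ
∑ˢ zero    F = F []
∑ˢ (suc n) F = ∑ˢ n (λ X → F (true ∷ X)) + ∑ˢ n (λ X → F (false ∷ X))

∑ˢ-cong : ∀ n {F G : Subset n → ℕ} → (∀ X → F X ≡ G X) → ∑ˢ n F ≡ ∑ˢ n G
∑ˢ-cong zero    F≗G = F≗G []
∑ˢ-cong (suc n) F≗G =
  cong₂ _+_ (∑ˢ-cong n (λ X → F≗G (true ∷ X))) (∑ˢ-cong n (λ X → F≗G (false ∷ X)))

∑ˢ-distrib-+ : ∀ n (F G : Subset n → ℕ) → ∑ˢ n (λ X → F X + G X) ≡ ∑ˢ n F + ∑ˢ n G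
∑ˢ-distrib-+ zero    F G = refl
∑ˢ-distrib-+ (suc n) F G = ≡.trans
  (cong₂ _+_ (∑ˢ-distrib-+ n (λ X → F (true ∷ X)) (λ X → G (true ∷ X)))
             (∑ˢ-distrib-+ n (λ X → F (false ∷ X)) (λ X → G (false ∷ X))))
  (interchange (∑ˢ n (λ X → F (true ∷ X))) (∑ˢ n (λ X → G (true ∷ X)))
               (∑ˢ n (λ X → F (false ∷ X))) (∑ˢ n (λ X → G (false ∷ X))))

∑ˢ-zero : ∀ n → ∑ˢ n (λ _ → 0) ≡ 0
∑ˢ-zero zero    = refl
∑ˢ-zero (suc n) = cong₂ _+_ (∑ˢ-zero n) (∑ˢ-zero n)

*-distribˡ-∑ˢ : ∀ n c (F : Subset n → ℕ) → c * ∑ˢ n F ≡ ∑ˢ n (λ X → c * F X)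
*-distribˡ-∑ˢ zero    c F = refl
*-distribˡ-∑ˢ (suc n) c F =
  ≡.trans (*-distribˡ-+ c _ _) (cong₂ _+_ (*-distribˡ-∑ˢ n c _) (*-distribˡ-∑ˢ n c _))

∑ˢ-∑-comm : ∀ n m (F : Subset n → Fin m → ℕ) →
            ∑ˢ n (λ X → ∑[ i < m ] F X i) ≡ ∑[ i < m ] ∑ˢ n (λ X → F X i)
∑ˢ-∑-comm n zero    F = ∑ˢ-zero n
∑ˢ-∑-comm n (suc m) F = ≡.trans (∑ˢ-distrib-+ n _ _)
  (cong (∑ˢ n (λ X → F X fzero) +_) (∑ˢ-∑-comm n m (λ X i → F X (fsuc i))))

∑ˢ-∑²-comm : ∀ n {m} (F : Subset n → Fin m → Fin m → ℕ) →
             ∑ˢ n (λ X → ∑² (F X)) ≡ ∑² (λ v w → ∑ˢ n (λ X → F X v w))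
∑ˢ-∑²-comm n {m} F = ≡.trans (∑ˢ-∑-comm n m (λ X v → ∑[ w < m ] F X v w))
                             (sum-cong-≗ (λ v → ∑ˢ-∑-comm n m (λ X → F X v)))

∑ˢ-δ : ∀ n (Y : Subset n) (F : Subset n → ℕ) → ∑ˢ n (λ X → ⟦ does (X ≟ˢ Y) ⟧ * F X) ≡ F Y
∑ˢ-δ zero    []          F = +-identityʳ (F [])
∑ˢ-δ (suc n) (true  ∷ Y) F =
  ≡.trans (cong₂ _+_ (∑ˢ-δ n Y (λ X → F (true ∷ X))) (∑ˢ-zero n)) (+-identityʳ _)
∑ˢ-δ (suc n) (false ∷ Y) F =
  ≡.trans (cong (_+ ∑ˢ n (λ X → ⟦ does (X ≟ˢ Y) ⟧ * F (false ∷ X))) (∑ˢ-zero n))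
          (∑ˢ-δ n Y (λ X → F (false ∷ X)))

∑ˢ-△ : ∀ n (Y : Subset n) (F : Subset n → ℕ) → ∑ˢ n F ≡ ∑ˢ n (λ X → F (Y △ X))
∑ˢ-△ zero    []          F = refl
∑ˢ-△ (suc n) (true  ∷ Y) F = ≡.trans (+-comm (∑ˢ n (λ X → F (true ∷ X))) _)
  (cong₂ _+_ (∑ˢ-△ n Y (λ X → F (false ∷ X))) (∑ˢ-△ n Y (λ X → F (true ∷ X))))
∑ˢ-△ (suc n) (false ∷ Y) F =
  cong₂ _+_ (∑ˢ-△ n Y (λ X → F (true ∷ X))) (∑ˢ-△ n Y (λ X → F (false ∷ X)))

∑ˢ-∁ : ∀ n (F : Subset n → ℕ) → ∑ˢ n F ≡ ∑ˢ n (λ X → F (∁ X))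
∑ˢ-∁ zero    F = refl
∑ˢ-∁ (suc n) F = ≡.trans (+-comm (∑ˢ n (λ X → F (true ∷ X))) _)
  (cong₂ _+_ (∑ˢ-∁ n (λ X → F (false ∷ X))) (∑ˢ-∁ n (λ X → F (true ∷ X))))

-- Counting

module _ {A : Set} {P : A → Set} (P? : ∀ x → Dec (P x)) where

  count-∷ : ∀ x xs → count P? (x ∷ xs) ≡ ⟦ does (P? x) ⟧ + count P? xs
  count-∷ x xs with does (P? x)
  ... | true  = refl
  ... | false = refl

  count-++ : ∀ xs ys → count P? (xs ++ ys) ≡ count P? xs + count P? ys
  count-++ xs ys = ≡.trans (cong length (List.filter-++ P? xs ys)) (List.length-++ (filter P? xs))

count-map : ∀ {A B : Set} {P : B → Set} (P? : ∀ x → Dec (P x)) (f : A → B) xs →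
            count P? (map f xs) ≡ count (λ x → P? (f x)) xs
count-map P? f []       = refl
count-map P? f (x ∷ xs) = ≡.trans (count-∷ P? (f x) (map f xs))
  (≡.trans (cong (⟦ does (P? (f x)) ⟧ +_) (count-map P? f xs)) (≡.sym (count-∷ (λ x → P? (f x)) x xs)))

count-tabulate : ∀ {n} {A : Set} {P : A → Set} (P? : ∀ x → Dec (P x)) (f : Fin n → A) →
                 count P? (tabulate f) ≡ ∑[ i < n ] ⟦ does (P? (f i)) ⟧
count-tabulate {zero}  P? f = refl
count-tabulate {suc n} P? f =
  ≡.trans (count-∷ P? (f fzero) _) (cong (_ +_) (count-tabulate P? (λ i → f (fsuc i))))

count-allSubsets : ∀ {n} {P : Subset n → Set} (P? : ∀ X → Dec (P X)) →
                   count P? (allSubsets n) ≡ ∑ˢ n (λ X → ⟦ does (P? X) ⟧)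
count-allSubsets {zero}  P? = ≡.trans (count-∷ P? [] _) (+-identityʳ _)
count-allSubsets {suc n} P? = ≡.trans (count-++ P? (map (true ∷_) (allSubsets n)) _)
  (cong₂ _+_ (≡.trans (count-map P? (true ∷_) (allSubsets n)) (count-allSubsets (λ X → P? (true ∷ X))))
             (≡.trans (count-map P? (false ∷_) (allSubsets n)) (count-allSubsets (λ X → P? (false ∷ X)))))

count-allSubsets-∁ : ∀ {n} {P : Subset n → Set} (P? : ∀ X → Dec (P X)) →
                     count P? (allSubsets n) ≡ count (λ X → P? (∁ X)) (allSubsets n)
count-allSubsets-∁ {n} P? = ≡.trans (count-allSubsets P?)
  (≡.trans (∑ˢ-∁ n _) (≡.sym (count-allSubsets (λ X → P? (∁ X)))))

count-⇔ : ∀ {A : Set} {P Q : A → Set} (P? : ∀ x → Dec (P x)) (Q? : ∀ x → Dec (Q x)) →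
          (∀ x → P x ⇔ Q x) → ∀ xs → count P? xs ≡ count Q? xs
count-⇔ P? Q? P⇔Q xs =
  cong length (List.filter-≐ P? Q? ((λ {x} → Equivalence.to (P⇔Q x)) , (λ {x} → Equivalence.from (P⇔Q x))) xs)

-- Two-element subsets

pair : ∀ {n} → Fin n → Fin n → Subset n
pair v w = ⁅ v ⁆ ∪ ⁅ w ⁆

lookup-⁅⁆ : ∀ {n} (x i : Fin n) → lookup ⁅ x ⁆ i ≡ does (i ≟ x)
lookup-⁅⁆ fzero    fzero    = refl
lookup-⁅⁆ fzero    (fsuc i) = Vec.lookup-replicate i false
lookup-⁅⁆ (fsuc x) fzero    = refl
lookup-⁅⁆ (fsuc x) (fsuc i) = lookup-⁅⁆ x i

lookup-pair : ∀ {n} (v w i : Fin n) → lookup (pair v w) i ≡ does (i ≟ v) ∨ does (i ≟ w)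
lookup-pair v w i =
  ≡.trans (Vec.lookup-zipWith _∨_ i ⁅ v ⁆ ⁅ w ⁆) (cong₂ _∨_ (lookup-⁅⁆ v i) (lookup-⁅⁆ w i))

v∈pair : ∀ {n} (v w : Fin n) → v ∈ pair v w
v∈pair v w = p⊆p∪q ⁅ w ⁆ (x∈⁅x⁆ v)

w∈pair : ∀ {n} (v w : Fin n) → w ∈ pair v w
w∈pair v w = q⊆p∪q ⁅ v ⁆ ⁅ w ⁆ (x∈⁅x⁆ w)

∈pair⇒ : ∀ {n} {x : Fin n} (v w : Fin n) → x ∈ pair v w → x ≡ v ⊎ x ≡ w
∈pair⇒ v w x∈ = Sum.map (x∈⁅y⁆⇒x≡y v) (x∈⁅y⁆⇒x≡y w) (x∈p∪q⁻ ⁅ v ⁆ ⁅ w ⁆ x∈)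

pair-injective : ∀ {n} {a b v w : Fin n} → a ≢ b → pair a b ≡ pair v w →
                (v ≡ a × w ≡ b) ⊎ (v ≡ b × w ≡ a)
pair-injective {a = a} {b} {v} {w} a≢b eq
  with ∈pair⇒ a b (≡.subst (v ∈_) (≡.sym eq) (v∈pair v w))
     | ∈pair⇒ a b (≡.subst (w ∈_) (≡.sym eq) (w∈pair v w))
     | ∈pair⇒ v w (≡.subst (a ∈_) eq (v∈pair a b))
     | ∈pair⇒ v w (≡.subst (b ∈_) eq (w∈pair a b))
... | inj₁ v≡a | inj₂ w≡b | _        | _        = inj₁ (v≡a , w≡b)
... | inj₂ v≡b | inj₁ w≡a | _        | _        = inj₂ (v≡b , w≡a)
... | inj₁ v≡a | inj₁ w≡a | _        | inj₁ b≡v = contradiction (≡.trans b≡v v≡a) (a≢b ∘ ≡.sym)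
... | inj₁ v≡a | inj₁ w≡a | _        | inj₂ b≡w = contradiction (≡.trans b≡w w≡a) (a≢b ∘ ≡.sym)
... | inj₂ v≡b | inj₂ w≡b | inj₁ a≡v | _        = contradiction (≡.trans a≡v v≡b) a≢b
... | inj₂ v≡b | inj₂ w≡b | inj₂ a≡w | _        = contradiction (≡.trans a≡w w≡b) a≢b

△-cancelˡ : ∀ {n} (p q : Subset n) → p △ (p △ q) ≡ q
△-cancelˡ []          []      = refl
△-cancelˡ (true  ∷ p) (b ∷ q) = cong₂ _∷_ (not-involutive b) (△-cancelˡ p q)
△-cancelˡ (false ∷ p) (b ∷ q) = cong (b ∷_) (△-cancelˡ p q)

∣p∣≡∑ : ∀ {n} (p : Subset n) → ∣ p ∣ ≡ ∑[ i < n ] ⟦ lookup p i ⟧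
∣p∣≡∑ []          = refl
∣p∣≡∑ (true  ∷ p) = cong suc (∣p∣≡∑ p)
∣p∣≡∑ (false ∷ p) = ∣p∣≡∑ p

∣p△q∣+2∣p∩q∣≡∣p∣+∣q∣ : ∀ {n} (p q : Subset n) →
                       ∣ p △ q ∣ + 2 * ∣ p ∩ q ∣ ≡ ∣ p ∣ + ∣ q ∣
∣p△q∣+2∣p∩q∣≡∣p∣+∣q∣ []          []          = refl
∣p△q∣+2∣p∩q∣≡∣p∣+∣q∣ (true  ∷ p) (true  ∷ q) = begin
  ∣ p △ q ∣ + 2 * suc ∣ p ∩ q ∣         ≡⟨ cong (∣ p △ q ∣ +_) (*-suc 2 ∣ p ∩ q ∣) ⟩
  ∣ p △ q ∣ + (2 + 2 * ∣ p ∩ q ∣)       ≡⟨ +-suc ∣ p △ q ∣ _ ⟩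
  suc (∣ p △ q ∣ + suc (2 * ∣ p ∩ q ∣)) ≡⟨ cong suc (+-suc ∣ p △ q ∣ _) ⟩
  suc (suc (∣ p △ q ∣ + 2 * ∣ p ∩ q ∣)) ≡⟨ cong (suc ∘ suc) (∣p△q∣+2∣p∩q∣≡∣p∣+∣q∣ p q) ⟩
  suc (suc (∣ p ∣ + ∣ q ∣))             ≡⟨ cong suc (+-suc ∣ p ∣ ∣ q ∣) ⟨
  suc ∣ p ∣ + suc ∣ q ∣                 ∎
∣p△q∣+2∣p∩q∣≡∣p∣+∣q∣ (true  ∷ p) (false ∷ q) = cong suc (∣p△q∣+2∣p∩q∣≡∣p∣+∣q∣ p q)
∣p△q∣+2∣p∩q∣≡∣p∣+∣q∣ (false ∷ p) (true  ∷ q) =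
  ≡.trans (cong suc (∣p△q∣+2∣p∩q∣≡∣p∣+∣q∣ p q)) (≡.sym (+-suc ∣ p ∣ ∣ q ∣))
∣p△q∣+2∣p∩q∣≡∣p∣+∣q∣ (false ∷ p) (false ∷ q) = ∣p△q∣+2∣p∩q∣≡∣p∣+∣q∣ p q

∣p∩pair∣ : ∀ {n} (p : Subset n) {v w : Fin n} → v ≢ w →
            ∣ p ∩ pair v w ∣ ≡ ⟦ lookup p v ⟧ + ⟦ lookup p w ⟧
∣p∩pair∣ {n} p {v} {w} v≢w = begin
  ∣ p ∩ pair v w ∣
    ≡⟨ ∣p∣≡∑ (p ∩ pair v w) ⟩
  ∑[ i < n ] ⟦ lookup (p ∩ pair v w) i ⟧
    ≡⟨ sum-cong-≗ split ⟩
  ∑[ i < n ] (⟦ does (i ≟ v) ⟧ * ⟦ lookup p i ⟧ + ⟦ does (i ≟ w) ⟧ * ⟦ lookup p i ⟧)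
    ≡⟨ ∑-distrib-+ (λ i → ⟦ does (i ≟ v) ⟧ * ⟦ lookup p i ⟧)
                   (λ i → ⟦ does (i ≟ w) ⟧ * ⟦ lookup p i ⟧) ⟩
  ∑[ i < n ] (⟦ does (i ≟ v) ⟧ * ⟦ lookup p i ⟧) + ∑[ i < n ] (⟦ does (i ≟ w) ⟧ * ⟦ lookup p i ⟧)
    ≡⟨ cong₂ _+_ (∑-δ v (λ i → ⟦ lookup p i ⟧)) (∑-δ w (λ i → ⟦ lookup p i ⟧)) ⟩
  ⟦ lookup p v ⟧ + ⟦ lookup p w ⟧ ∎
  where
  split : ∀ i → ⟦ lookup (p ∩ pair v w) i ⟧
              ≡ ⟦ does (i ≟ v) ⟧ * ⟦ lookup p i ⟧ + ⟦ does (i ≟ w) ⟧ * ⟦ lookup p i ⟧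
  split i rewrite Vec.lookup-zipWith _∧_ i p (pair v w) | lookup-pair v w i
    with i ≟ v | i ≟ w | lookup p i
  ... | yes refl | yes refl | _     = contradiction refl v≢w
  ... | yes _    | no _     | true  = refl
  ... | yes _    | no _     | false = refl
  ... | no _     | yes _    | true  = refl
  ... | no _     | yes _    | false = refl
  ... | no _     | no _     | true  = refl
  ... | no _     | no _     | false = refl

∣pair∣≡2 : ∀ {n} {v w : Fin n} → v ≢ w → ∣ pair v w ∣ ≡ 2
∣pair∣≡2 {n} {v} {w} v≢w = begin
  ∣ pair v w ∣                    ≡⟨ cong ∣_∣ (∩-identityˡ (pair v w)) ⟨
  ∣ ⊤ ∩ pair v w ∣                ≡⟨ ∣p∩pair∣ ⊤ v≢w ⟩
  ⟦ lookup ⊤ v ⟧ + ⟦ lookup ⊤ w ⟧ ≡⟨ cong₂ (λ s t → ⟦ s ⟧ + ⟦ t ⟧) (Vec.lookup-replicate v true)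
                                                                   (Vec.lookup-replicate w true) ⟩
  2                               ∎

does-pair⊆? : ∀ {n} (p : Subset n) (v w : Fin n) → does (pair v w ⊆? p) ≡ lookup p v ∧ lookup p w
does-pair⊆? p v w with lookup p v in pv | lookup p w in pw
... | true  | true  = dec-true (pair v w ⊆? p) λ {x} x∈ → Vec.lookup⇒[]= x p (pair⊆p x∈)
  where
  pair⊆p : ∀ {x} → x ∈ pair v w → lookup p x ≡ true
  pair⊆p x∈ with ∈pair⇒ v w x∈
  ... | inj₁ refl = pv
  ... | inj₂ refl = pw
... | true  | false = dec-false (pair v w ⊆? p) λ sub →
  contradiction (≡.trans (≡.sym (Vec.[]=⇒lookup (sub (w∈pair v w)))) pw) λ ()
... | false | _     = dec-false (pair v w ⊆? p) λ sub →
  contradiction (≡.trans (≡.sym (Vec.[]=⇒lookup (sub (v∈pair v w)))) pv) λ ()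

does-∣p△pair∣≟∣p∣ : ∀ {n} (p : Subset n) {v w : Fin n} → v ≢ w →
                    does (∣ p △ pair v w ∣ ≟ℕ ∣ p ∣) ≡ lookup p v xor lookup p w
does-∣p△pair∣≟∣p∣ p {v} {w} v≢w = compare ∣ p △ pair v w ∣ ∣ p ∣ (lookup p v) (lookup p w) (begin
  ∣ p △ pair v w ∣ + 2 * (⟦ lookup p v ⟧ + ⟦ lookup p w ⟧)
    ≡⟨ cong (λ m → ∣ p △ pair v w ∣ + 2 * m) (∣p∩pair∣ p v≢w) ⟨
  ∣ p △ pair v w ∣ + 2 * ∣ p ∩ pair v w ∣
    ≡⟨ ∣p△q∣+2∣p∩q∣≡∣p∣+∣q∣ p (pair v w) ⟩
  ∣ p ∣ + ∣ pair v w ∣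
    ≡⟨ cong (∣ p ∣ +_) (∣pair∣≡2 v≢w) ⟩
  ∣ p ∣ + 2 ∎)
  where
  compare : ∀ x k s t → x + 2 * (⟦ s ⟧ + ⟦ t ⟧) ≡ k + 2 → does (x ≟ℕ k) ≡ s xor t
  compare x k true  true  e = dec-false (x ≟ℕ k) λ { refl → contradiction (+-cancelˡ-≡ x 4 2 e) λ () }
  compare x k true  false e = dec-true  (x ≟ℕ k) (+-cancelʳ-≡ 2 x k e)
  compare x k false true  e = dec-true  (x ≟ℕ k) (+-cancelʳ-≡ 2 x k e)
  compare x k false false e = dec-false (x ≟ℕ k) λ { refl → contradiction (+-cancelˡ-≡ x 0 2 e) λ () }

-- Double counting in a regular graph

module _ {n : ℕ} (L : SimpleGraph n) where

  adj⇒≢ : ∀ {v w} → Adj L v w ≡ true → v ≢ w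
  adj⇒≢ {v} adj refl = contradiction (≡.trans (≡.sym adj) (irrefl L v)) λ ()

  isEdgeᵇ : Subset n → Bool
  isEdgeᵇ X = does (isEdge? L X)

  ∑-ordered-pairs≡2*isEdge : ∀ X →
    ∑² (λ v w → ⟦ does (X ≟ˢ pair v w) ⟧ * ⟦ Adj L v w ⟧) ≡ 2 * ⟦ isEdgeᵇ X ⟧
  ∑-ordered-pairs≡2*isEdge X with isEdge? L X
  ... | no ¬edge = ≡.trans (∑²-cong vanish) (∑²-zero {n})
    where
    vanish : ∀ v w → ⟦ does (X ≟ˢ pair v w) ⟧ * ⟦ Adj L v w ⟧ ≡ 0
    vanish v w with X ≟ˢ pair v w | Adj L v w in adj
    ... | yes X≡vw | true  = contradiction (v , w , adj , X≡vw) ¬edge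
    ... | yes _    | false = refl
    ... | no _     | _     = refl
  ... | yes (a , b , adj , refl) = begin
    ∑² (λ v w → ⟦ does (pair a b ≟ˢ pair v w) ⟧ * ⟦ Adj L v w ⟧)
      ≡⟨ ∑²-cong split ⟩
    ∑² (λ v w → ⟦ does (v ≟ a) ⟧ * ⟦ does (w ≟ b) ⟧ + ⟦ does (v ≟ b) ⟧ * ⟦ does (w ≟ a) ⟧)
      ≡⟨ ∑²-distrib-+ (λ v w → ⟦ does (v ≟ a) ⟧ * ⟦ does (w ≟ b) ⟧)
                      (λ v w → ⟦ does (v ≟ b) ⟧ * ⟦ does (w ≟ a) ⟧) ⟩
    ∑² (λ v w → ⟦ does (v ≟ a) ⟧ * ⟦ does (w ≟ b) ⟧)
      + ∑² (λ v w → ⟦ does (v ≟ b) ⟧ * ⟦ does (w ≟ a) ⟧)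
      ≡⟨ cong₂ _+_ (∑²-δ a b) (∑²-δ b a) ⟩
    2 ∎
    where
    a≢b : a ≢ b
    a≢b = adj⇒≢ adj

    split : ∀ v w → ⟦ does (pair a b ≟ˢ pair v w) ⟧ * ⟦ Adj L v w ⟧
                  ≡ ⟦ does (v ≟ a) ⟧ * ⟦ does (w ≟ b) ⟧ + ⟦ does (v ≟ b) ⟧ * ⟦ does (w ≟ a) ⟧
    split v w with pair a b ≟ˢ pair v w
    ... | no ab≢vw = ≡.sym (cong₂ _+_
      (⟦⟧*⟦⟧≡0 (v ≟ a) (w ≟ b) λ { (refl , refl) → ab≢vw refl })
      (⟦⟧*⟦⟧≡0 (v ≟ b) (w ≟ a) λ { (refl , refl) → ab≢vw (∪-comm ⁅ a ⁆ ⁅ b ⁆) }))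
    ... | yes ab≡vw with pair-injective a≢b ab≡vw
    ... | inj₁ (refl , refl)
      rewrite adj | dec-true (a ≟ a) refl | dec-true (b ≟ b) refl | dec-false (a ≟ b) a≢b = refl
    ... | inj₂ (refl , refl)
      rewrite SimpleGraph.sym L b a | adj | dec-true (a ≟ a) refl | dec-true (b ≟ b) refl
            | dec-false (b ≟ a) (a≢b ∘ ≡.sym) = refl

  2*∑ˢ-edges≡∑²-adjacent : ∀ (q : Subset n → Bool) →
    2 * ∑ˢ n (λ X → ⟦ q X ∧ isEdgeᵇ X ⟧) ≡ ∑² (λ v w → ⟦ Adj L v w ⟧ * ⟦ q (pair v w) ⟧)
  2*∑ˢ-edges≡∑²-adjacent q = begin
    2 * ∑ˢ n (λ X → ⟦ q X ∧ isEdgeᵇ X ⟧)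
      ≡⟨ *-distribˡ-∑ˢ n 2 (λ X → ⟦ q X ∧ isEdgeᵇ X ⟧) ⟩
    ∑ˢ n (λ X → 2 * ⟦ q X ∧ isEdgeᵇ X ⟧)
      ≡⟨ ∑ˢ-cong n by-ordered-pairs ⟩
    ∑ˢ n (λ X → ∑² (λ v w → ⟦ does (X ≟ˢ pair v w) ⟧ * term v w))
      ≡⟨ ∑ˢ-∑²-comm n (λ X v w → ⟦ does (X ≟ˢ pair v w) ⟧ * term v w) ⟩
    ∑² (λ v w → ∑ˢ n (λ X → ⟦ does (X ≟ˢ pair v w) ⟧ * term v w))
      ≡⟨ ∑²-cong (λ v w → ∑ˢ-δ n (pair v w) (λ _ → term v w)) ⟩
    ∑² term ∎
    where
    term : Fin n → Fin n → ℕ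
    term v w = ⟦ Adj L v w ⟧ * ⟦ q (pair v w) ⟧

    2⟦∧⟧ : ∀ a b → 2 * ⟦ a ∧ b ⟧ ≡ ⟦ a ⟧ * (2 * ⟦ b ⟧)
    2⟦∧⟧ true  b = ≡.sym (+-identityʳ (2 * ⟦ b ⟧))
    2⟦∧⟧ false b = refl

    move : ∀ X v w →
           ⟦ q X ⟧ * (⟦ does (X ≟ˢ pair v w) ⟧ * ⟦ Adj L v w ⟧) ≡ ⟦ does (X ≟ˢ pair v w) ⟧ * term v w
    move X v w with X ≟ˢ pair v w
    ... | no _ = *-zeroʳ ⟦ q X ⟧
    ... | yes refl with q (pair v w) | Adj L v w
    ... | true  | true  = refl
    ... | true  | false = refl
    ... | false | true  = refl
    ... | false | false = refl

    by-ordered-pairs : ∀ X →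
      2 * ⟦ q X ∧ isEdgeᵇ X ⟧ ≡ ∑² (λ v w → ⟦ does (X ≟ˢ pair v w) ⟧ * term v w)
    by-ordered-pairs X = begin
      2 * ⟦ q X ∧ isEdgeᵇ X ⟧
        ≡⟨ 2⟦∧⟧ (q X) (isEdgeᵇ X) ⟩
      ⟦ q X ⟧ * (2 * ⟦ isEdgeᵇ X ⟧)
        ≡⟨ cong (⟦ q X ⟧ *_) (∑-ordered-pairs≡2*isEdge X) ⟨
      ⟦ q X ⟧ * ∑² (λ v w → ⟦ does (X ≟ˢ pair v w) ⟧ * ⟦ Adj L v w ⟧)
        ≡⟨ *-distribˡ-∑² ⟦ q X ⟧ (λ v w → ⟦ does (X ≟ˢ pair v w) ⟧ * ⟦ Adj L v w ⟧) ⟩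
      ∑² (λ v w → ⟦ q X ⟧ * (⟦ does (X ≟ˢ pair v w) ⟧ * ⟦ Adj L v w ⟧))
        ≡⟨ ∑²-cong (move X) ⟩
      ∑² (λ v w → ⟦ does (X ≟ˢ pair v w) ⟧ * term v w) ∎

  adj-*-cong : ∀ v w {a b : ℕ} → (Adj L v w ≡ true → a ≡ b) →
               ⟦ Adj L v w ⟧ * a ≡ ⟦ Adj L v w ⟧ * b
  adj-*-cong v w a≡b with Adj L v w
  ... | true  = cong (1 *_) (a≡b refl)
  ... | false = refl

  degree≡∑Adj : ∀ v → degree L v ≡ ∑[ w < n ] ⟦ Adj L v w ⟧
  degree≡∑Adj v = ≡.trans (count-tabulate (λ w → Adj L v w ≟ᵇ true) (λ w → w))
                          (sum-cong-≗ (λ w → is-true (Adj L v w)))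
    where
    is-true : ∀ b → ⟦ does (b ≟ᵇ true) ⟧ ≡ ⟦ b ⟧
    is-true true  = refl
    is-true false = refl

  cut : Subset n → ℕ
  cut T = ∑² (λ v w → ⟦ Adj L v w ⟧ * ⟦ lookup T v xor lookup T w ⟧)

  inner : Subset n → ℕ
  inner T = ∑² (λ v w → ⟦ Adj L v w ⟧ * ⟦ lookup T v ∧ lookup T w ⟧)

  2*degₖ≡cut : ∀ k S → ∣ S ∣ ≡ k → 2 * degₖ L k S ≡ cut S
  2*degₖ≡cut _ S refl = begin
    2 * degₖ L ∣ S ∣ S
      ≡⟨ cong (2 *_) (count-allSubsets (λ W → (∣ W ∣ ≟ℕ ∣ S ∣) ×-dec isEdge? L (S △ W))) ⟩
    2 * ∑ˢ n (λ W → ⟦ does (∣ W ∣ ≟ℕ ∣ S ∣) ∧ isEdgeᵇ (S △ W) ⟧)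
      ≡⟨ cong (2 *_) (∑ˢ-△ n S _) ⟩
    2 * ∑ˢ n (λ X → ⟦ does (∣ S △ X ∣ ≟ℕ ∣ S ∣) ∧ isEdgeᵇ (S △ (S △ X)) ⟧)
      ≡⟨ cong (2 *_) (∑ˢ-cong n λ X →
           cong (λ Y → ⟦ does (∣ S △ X ∣ ≟ℕ ∣ S ∣) ∧ isEdgeᵇ Y ⟧) (△-cancelˡ S X)) ⟩
    2 * ∑ˢ n (λ X → ⟦ does (∣ S △ X ∣ ≟ℕ ∣ S ∣) ∧ isEdgeᵇ X ⟧)
      ≡⟨ 2*∑ˢ-edges≡∑²-adjacent (λ X → does (∣ S △ X ∣ ≟ℕ ∣ S ∣)) ⟩
    ∑² (λ v w → ⟦ Adj L v w ⟧ * ⟦ does (∣ S △ pair v w ∣ ≟ℕ ∣ S ∣) ⟧)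
      ≡⟨ ∑²-cong (λ v w → adj-*-cong v w (cong ⟦_⟧ ∘ does-∣p△pair∣≟∣p∣ S ∘ adj⇒≢)) ⟩
    cut S ∎

  2*inducedEdges≡inner : ∀ S → 2 * inducedEdges L S ≡ inner S
  2*inducedEdges≡inner S = begin
    2 * inducedEdges L S
      ≡⟨ cong (2 *_) (count-allSubsets (λ X → (∣ X ∣ ≟ℕ 2) ×-dec ((X ⊆? S) ×-dec isEdge? L X))) ⟩
    2 * ∑ˢ n (λ X → ⟦ does (∣ X ∣ ≟ℕ 2) ∧ (does (X ⊆? S) ∧ isEdgeᵇ X) ⟧)
      ≡⟨ cong (2 *_) (∑ˢ-cong n (λ X → cong ⟦_⟧ (∧-assoc (does (∣ X ∣ ≟ℕ 2)) _ _))) ⟨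
    2 * ∑ˢ n (λ X → ⟦ (does (∣ X ∣ ≟ℕ 2) ∧ does (X ⊆? S)) ∧ isEdgeᵇ X ⟧)
      ≡⟨ 2*∑ˢ-edges≡∑²-adjacent (λ X → does (∣ X ∣ ≟ℕ 2) ∧ does (X ⊆? S)) ⟩
    ∑² (λ v w → ⟦ Adj L v w ⟧ * ⟦ does (∣ pair v w ∣ ≟ℕ 2) ∧ does (pair v w ⊆? S) ⟧)
      ≡⟨ ∑²-cong (λ v w → adj-*-cong v w λ adj →
           cong₂ (λ a b → ⟦ a ∧ b ⟧) (dec-true (∣ pair v w ∣ ≟ℕ 2) (∣pair∣≡2 (adj⇒≢ adj)))
                                     (does-pair⊆? S v w)) ⟩
    inner S ∎

  cut+2*inner≡2*∣T∣*d : ∀ {d} → Regular L d → ∀ T → cut T + 2 * inner T ≡ 2 * (∣ T ∣ * d)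
  cut+2*inner≡2*∣T∣*d {d} regular T = begin
    cut T + 2 * inner T
      ≡⟨ cong (cut T +_) (*-distribˡ-∑² 2 (λ v w → ⟦ Adj L v w ⟧ * ⟦ T[ v ] ∧ T[ w ] ⟧)) ⟩
    cut T + ∑² (λ v w → 2 * (⟦ Adj L v w ⟧ * ⟦ T[ v ] ∧ T[ w ] ⟧))
      ≡⟨ ∑²-distrib-+ (λ v w → ⟦ Adj L v w ⟧ * ⟦ T[ v ] xor T[ w ] ⟧)
                      (λ v w → 2 * (⟦ Adj L v w ⟧ * ⟦ T[ v ] ∧ T[ w ] ⟧)) ⟨
    ∑² (λ v w → ⟦ Adj L v w ⟧ * ⟦ T[ v ] xor T[ w ] ⟧ + 2 * (⟦ Adj L v w ⟧ * ⟦ T[ v ] ∧ T[ w ] ⟧))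
      ≡⟨ ∑²-cong (λ v w → weighted (Adj L v w) T[ v ] T[ w ]) ⟩
    ∑² (λ v w → ⟦ Adj L v w ⟧ * ⟦ T[ v ] ⟧ + ⟦ Adj L v w ⟧ * ⟦ T[ w ] ⟧)
      ≡⟨ ∑²-distrib-+ (λ v w → ⟦ Adj L v w ⟧ * ⟦ T[ v ] ⟧) (λ v w → ⟦ Adj L v w ⟧ * ⟦ T[ w ] ⟧) ⟩
    ends + ∑² (λ v w → ⟦ Adj L v w ⟧ * ⟦ T[ w ] ⟧)
      ≡⟨ cong (ends +_) (≡.trans (∑-comm (λ v w → ⟦ Adj L v w ⟧ * ⟦ T[ w ] ⟧))
                                 (∑²-cong λ v w → cong (λ b → ⟦ b ⟧ * ⟦ T[ v ] ⟧) (SimpleGraph.sym L w v))) ⟩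
    ends + ends
      ≡⟨ cong (ends +_) (+-identityʳ ends) ⟨
    2 * ends
      ≡⟨ cong (2 *_) ends≡∣T∣*d ⟩
    2 * (∣ T ∣ * d) ∎
    where
    T[_] : Fin n → Bool
    T[ v ] = lookup T v

    ends : ℕ
    ends = ∑² (λ v w → ⟦ Adj L v w ⟧ * ⟦ T[ v ] ⟧)

    weighted : ∀ e s t →
               ⟦ e ⟧ * ⟦ s xor t ⟧ + 2 * (⟦ e ⟧ * ⟦ s ∧ t ⟧) ≡ ⟦ e ⟧ * ⟦ s ⟧ + ⟦ e ⟧ * ⟦ t ⟧
    weighted false s     t     = refl
    weighted true  true  true  = refl
    weighted true  true  false = refl
    weighted true  false true  = refl
    weighted true  false false = refl

    ends≡∣T∣*d : ends ≡ ∣ T ∣ * d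
    ends≡∣T∣*d = begin
      ∑[ v < n ] ∑[ w < n ] (⟦ Adj L v w ⟧ * ⟦ T[ v ] ⟧)
        ≡⟨ sum-cong-≗ (λ v → *-distribʳ-sum ⟦ T[ v ] ⟧ (λ w → ⟦ Adj L v w ⟧)) ⟨
      ∑[ v < n ] (∑[ w < n ] ⟦ Adj L v w ⟧ * ⟦ T[ v ] ⟧)
        ≡⟨ sum-cong-≗ (λ v → cong (_* ⟦ T[ v ] ⟧) (≡.trans (≡.sym (degree≡∑Adj v)) (regular v))) ⟩
      ∑[ v < n ] (d * ⟦ T[ v ] ⟧)
        ≡⟨ *-distribˡ-sum d (λ v → ⟦ T[ v ] ⟧) ⟨
      d * ∑[ v < n ] ⟦ T[ v ] ⟧
        ≡⟨ cong (d *_) (∣p∣≡∑ T) ⟨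
      d * ∣ T ∣
        ≡⟨ *-comm d ∣ T ∣ ⟩
      ∣ T ∣ * d ∎

  cut-∁ : ∀ T → cut (∁ T) ≡ cut T
  cut-∁ T = ∑²-cong λ v w → cong (λ b → ⟦ Adj L v w ⟧ * ⟦ b ⟧)
    (≡.trans (cong₂ _xor_ (Vec.lookup-map v not T) (Vec.lookup-map w not T))
             (not-xor-not (lookup T v) (lookup T w)))
    where
    not-xor-not : ∀ s t → not s xor not t ≡ s xor t
    not-xor-not true  t = refl
    not-xor-not false t = not-involutive t

  degₖ+2*inducedEdges≡∣T∣*d : ∀ {d} → Regular L d → ∀ {k} S T → ∣ S ∣ ≡ k → cut T ≡ cut S →
                              degₖ L k S + 2 * inducedEdges L T ≡ ∣ T ∣ * d
  degₖ+2*inducedEdges≡∣T∣*d {d} regular {k} S T ∣S∣≡k cutT≡cutS = *-cancelˡ-≡ _ _ 2 (begin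
    2 * (degₖ L k S + 2 * inducedEdges L T)
      ≡⟨ *-distribˡ-+ 2 (degₖ L k S) _ ⟩
    2 * degₖ L k S + 2 * (2 * inducedEdges L T)
      ≡⟨ cong₂ _+_ (≡.trans (2*degₖ≡cut k S ∣S∣≡k) (≡.sym cutT≡cutS)) (cong (2 *_) (2*inducedEdges≡inner T)) ⟩
    cut T + 2 * inner T
      ≡⟨ cut+2*inner≡2*∣T∣*d regular T ⟩
    2 * (∣ T ∣ * d) ∎)

  degₖ+2*inducedEdges : ∀ {d} → Regular L d → ∀ {k} S → ∣ S ∣ ≡ k →
                        degₖ L k S + 2 * inducedEdges L S ≡ k * d
  degₖ+2*inducedEdges {d} regular S ∣S∣≡k =
    ≡.trans (degₖ+2*inducedEdges≡∣T∣*d regular S S ∣S∣≡k refl) (cong (_* d) ∣S∣≡k)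

  degₖ+2*inducedEdges-∁ : ∀ {d} → Regular L d → ∀ {k} S → ∣ S ∣ ≡ k →
                          degₖ L k S + 2 * inducedEdges L (∁ S) ≡ (n ∸ k) * d
  degₖ+2*inducedEdges-∁ {d} regular S ∣S∣≡k =
    ≡.trans (degₖ+2*inducedEdges≡∣T∣*d regular S (∁ S) ∣S∣≡k (cut-∁ S))
            (cong (_* d) (≡.trans (∣∁p∣≡n∸∣p∣ S) (cong (n ∸_) ∣S∣≡k)))

module _ {n d : ℕ} (L : SimpleGraph n) (regular : Regular L d)
         {k : ℕ} (S₀ : Subset n) (∣S₀∣≡k : ∣ S₀ ∣ ≡ k) where

  degₖ≡⇔inducedEdges≡ : ∀ S → ∣ S ∣ ≡ k →
    (degₖ L k S ≡ degₖ L k S₀) ⇔ (inducedEdges L S ≡ inducedEdges L S₀)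
  degₖ≡⇔inducedEdges≡ S ∣S∣≡k = a+2b≡c+2d⇒a≡c⇔b≡d
    (≡.trans (degₖ+2*inducedEdges L regular S ∣S∣≡k)
             (≡.sym (degₖ+2*inducedEdges L regular S₀ ∣S₀∣≡k)))

  degₖ≡⇔inducedEdges-∁≡ : ∀ S → ∣ S ∣ ≡ k →
    (degₖ L k S ≡ degₖ L k S₀) ⇔ (inducedEdges L (∁ S) ≡ inducedEdges L (∁ S₀))
  degₖ≡⇔inducedEdges-∁≡ S ∣S∣≡k = a+2b≡c+2d⇒a≡c⇔b≡d
    (≡.trans (degₖ+2*inducedEdges-∁ L regular S ∣S∣≡k)
             (≡.sym (degₖ+2*inducedEdges-∁ L regular S₀ ∣S₀∣≡k)))

  cardVDk≡cardLkj : cardVDk L k (degₖ L k S₀) ≡ cardLkj L k (inducedEdges L S₀)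
  cardVDk≡cardLkj = count-⇔ _ _ (λ S → ×-⇔ ⇔.refl (degₖ≡⇔inducedEdges≡ S)) (allSubsets n)

  cardLkj≡cardLkj-∁ : k ≤ n →
    cardLkj L k (inducedEdges L S₀) ≡ cardLkj L (n ∸ k) (inducedEdges L (∁ S₀))
  cardLkj≡cardLkj-∁ k≤n = ≡.trans
    (count-⇔ _ _ (λ S → ×-⇔ (∣S∣≡k⇔∣∁S∣≡n∸k S) λ ∣S∣≡k →
                   ⇔.trans (⇔.sym (degₖ≡⇔inducedEdges≡ S ∣S∣≡k)) (degₖ≡⇔inducedEdges-∁≡ S ∣S∣≡k))
             (allSubsets n))
    (≡.sym (count-allSubsets-∁ λ T → (∣ T ∣ ≟ℕ n ∸ k) ×-dec (inducedEdges L T ≟ℕ inducedEdges L (∁ S₀))))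
    where
    ∣S∣≡k⇔∣∁S∣≡n∸k : ∀ S → (∣ S ∣ ≡ k) ⇔ (∣ ∁ S ∣ ≡ n ∸ k)
    ∣S∣≡k⇔∣∁S∣≡n∸k S = mk⇔
      (λ ∣S∣≡k → ≡.trans (∣∁p∣≡n∸∣p∣ S) (cong (n ∸_) ∣S∣≡k))
      (λ ∣∁S∣≡n∸k → begin
        ∣ S ∣             ≡⟨ m∸[m∸n]≡n (∣p∣≤n S) ⟨
        n ∸ (n ∸ ∣ S ∣)   ≡⟨ cong (n ∸_) (≡.trans (≡.sym (∣∁p∣≡n∸∣p∣ S)) ∣∁S∣≡n∸k) ⟩
        n ∸ (n ∸ k)       ≡⟨ m∸[m∸n]≡n k≤n ⟩
        k                 ∎)

proposition5p10 : (n d : ℕ) (L : SimpleGraph n) → Connected L → Regular L d →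
    (k : ℕ) → 1 ≤ k → k < n → (l : ℕ) → InDk L k l →
    (cardVDk L k l ≡ cardLkj L k ((k * d ∸ l) / 2))
    × (cardLkj L k ((k * d ∸ l) / 2) ≡ cardLkj L (n ∸ k) (((n ∸ k) * d ∸ l) / 2))
proposition5p10 n d L _ regular k _ k<n _ (S₀ , ∣S₀∣≡k , refl) =
  ≡.trans (cardVDk≡cardLkj L regular S₀ ∣S₀∣≡k) (cong (cardLkj L k) (≡.sym j≡e₀)) ,
  ≡.trans (cong (cardLkj L k) j≡e₀)
    (≡.trans (cardLkj≡cardLkj-∁ L regular S₀ ∣S₀∣≡k (<⇒≤ k<n))
             (cong (cardLkj L (n ∸ k)) (≡.sym j′≡e₀ᶜ)))
  where
  j≡e₀ : (k * d ∸ degₖ L k S₀) / 2 ≡ inducedEdges L S₀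
  j≡e₀ = [m∸l]/2≡e {degₖ L k S₀} (degₖ+2*inducedEdges L regular S₀ ∣S₀∣≡k)

  j′≡e₀ᶜ : ((n ∸ k) * d ∸ degₖ L k S₀) / 2 ≡ inducedEdges L (∁ S₀)
  j′≡e₀ᶜ = [m∸l]/2≡e {degₖ L k S₀} (degₖ+2*inducedEdges-∁ L regular S₀ ∣S₀∣≡k)
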